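{- The inquisitive (global) disjunction $\vee$ is strongly undefinable in extended propositional dependence logic $\mathbf{PD}^+$: for every context $\varphi(a,b)$ of $\mathbf{PD}^+$ and any two distinct atoms $p,q$ not occurring in $\varphi(a,b)$, $\varphi(=\!(p),=\!(q))\not\equiv_{M_{pq}} {=\!(p)}\vee{=\!(q)}$ (hence $\varphi(=\!(p),=\!(q))\not\equiv {=\!(p)}\vee{=\!(q)}$), where $M_{pq}$ has worlds $W=\{w_1,w_2,w_3\}$, $p$ true exactly at $w_1,w_2$, $q$ true exactly at $w_2,w_3$, and every other atom false at all worlds.
   Context: Inquisitive semantics: a model is $M=(W,V)$ with $V$ assigning to each world a set of propositional letters; formulas are supported by states $s\subseteq W$. Clauses: $s\models p$ iff $p\in V(w)$ for all $w\in s$; $s\models\neg p$ iff $p\notin V(w)$ for all $w\in s$; $s\models\bot$ iff $s=\emptyset$; $s\models\psi\land\chi$ iff both; $s\models\psi\vee\chi$ (inquisitive disjunction) iff $s\models\psi$ or $s\models\chi$; $s\models\psi\otimes\chi$ iff $s=t_1\cup t_2$ with $t_1\models\psi$, $t_2\models\chi$. Extended propositional dependence logic $\mathbf{PD}^+$ has formulas $\varphi::= p\mid\neg p\mid\bot\mid =\!(\alpha_1,\dots,\alpha_n;\beta)\mid\varphi\land\varphi\mid\varphi\otimes\varphi$, where $\alpha_i,\beta$ are classical formulas (built from $p,\neg p,\bot,\land,\otimes$ without dependence atoms), and $s\models\, =\!(\alpha_1,\dots,\alpha_n;\beta)$ iff for all $w,w'\in s$, if $\{w\}$ and $\{w'\}$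 agree on supporting $\alpha_1\land\dots\land\alpha_n$ then they agree on supporting $\beta$. The constancy atom $=\!(q)$ is the case $n=0$ with $\beta=q$. A context $\varphi(a,b)$ is a formula in which $a,b$ occur neither negated nor inside a dependence atom. $\equiv_M$ means support by the same states of $M$; $\equiv$ means equivalence in all models. -}

module Defs where

open import Data.Nat using (ℕ; _≡ᵇ_)
open import Data.Bool using (Bool; true; false; _∨_; _∧_; T)
open import Data.Fin using (Fin; zero; suc)
open import Data.Fin.Subset using (Subset; _∈_; _∪_; ⁅_⁆) renaming (⊥ to ∅)
open import Data.List using (List; []; _∷_)
open import Data.Product using (_×_; ∃₂)
open import Data.Sum using (_⊎_)
open import Data.Unit using (⊤)
open import Data.Empty using (⊥)
open import Relation.Binary.PropositionalEquality using (_≡_; _≢_)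

Atom : Set
Atom = ℕ

-- A model with finitely many worlds W = Fin n; V w r = true iff r ∈ V(w).
record Model : Set where
  field
    size : ℕ
    val  : Fin size → Atom → Bool
open Model public

State : Model → Set
State M = Subset (size M)

data Cl : Set where
  atm  : Atom → Cl
  natm : Atom → Cl
  bot  : Cl
  _∧ᶜ_ : Cl → Cl → Cl
  _⊗ᶜ_ : Cl → Cl → Cl

-- PD⁺ formulas with holes from H.  PD⁺ formulas proper: H = ⊥.
-- Holes may only appear as whole subformulas combined by ∧ and ⊗,
-- so they occur neither negated nor inside a dependence atom.
data Form (H : Set) : Set where
  atm  : Atom → Form H
  natm : Atom → Form H
  bot  : Form H
  dep  : List Cl → Cl → Form H
  _∧ᶠ_ : Form H → Form H → Form H
  _⊗ᶠ_ : Form H → Form H → Form H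
  hole : H → Form H

PD⁺ : Set
PD⁺ = Form ⊥

data Hole : Set where
  a b : Hole

Context : Set
Context = Form Hole

subst : {H : Set} → Form H → (H → PD⁺) → PD⁺
subst (atm r) σ = atm r
subst (natm r) σ = natm r
subst bot σ = bot
subst (dep αs β) σ = dep αs β
subst (φ ∧ᶠ ψ) σ = subst φ σ ∧ᶠ subst ψ σ
subst (φ ⊗ᶠ ψ) σ = subst φ σ ⊗ᶠ subst ψ σ
subst (hole h) σ = σ h

_[_,_] : Context → PD⁺ → PD⁺ → PD⁺
φ [ ψ₁ , ψ₂ ] = subst φ σ
  where
  σ : Hole → PD⁺
  σ a = ψ₁
  σ b = ψ₂

const : Atom → PD⁺
const q = dep [] (atm q)

_⊨ᶜ_ : {M : Model} → State M → Cl → Set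
_⊨ᶜ_ {M} s (atm r)  = ∀ w → w ∈ s → T (val M w r)
_⊨ᶜ_ {M} s (natm r) = ∀ w → w ∈ s → T (val M w r) → ⊥
_⊨ᶜ_ {M} s bot      = s ≡ ∅
_⊨ᶜ_ {M} s (α ∧ᶜ β) = (_⊨ᶜ_ {M} s α) × (_⊨ᶜ_ {M} s β)
_⊨ᶜ_ {M} s (α ⊗ᶜ β) = ∃₂ λ (t₁ t₂ : State M) → s ≡ t₁ ∪ t₂ × _⊨ᶜ_ {M} t₁ α × _⊨ᶜ_ {M} t₂ β

_⊨ᶜ*_ : {M : Model} → State M → List Cl → Set
_⊨ᶜ*_ {M} s []       = ⊤
_⊨ᶜ*_ {M} s (α ∷ αs) = (_⊨ᶜ_ {M} s α) × (_⊨ᶜ*_ {M} s αs)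

_⇔_ : Set → Set → Set
A ⇔ B = (A → B) × (B → A)

_⊨_ : {M : Model} → State M → PD⁺ → Set
_⊨_ {M} s (atm r)  = ∀ w → w ∈ s → T (val M w r)
_⊨_ {M} s (natm r) = ∀ w → w ∈ s → T (val M w r) → ⊥
_⊨_ {M} s bot      = s ≡ ∅
_⊨_ {M} s (dep αs β) =
  ∀ w w' → w ∈ s → w' ∈ s →
    (_⊨ᶜ*_ {M} ⁅ w ⁆ αs ⇔ _⊨ᶜ*_ {M} ⁅ w' ⁆ αs) →
    (_⊨ᶜ_ {M} ⁅ w ⁆ β ⇔ _⊨ᶜ_ {M} ⁅ w' ⁆ β)
_⊨_ {M} s (φ ∧ᶠ ψ) = (_⊨_ {M} s φ) × (_⊨_ {M} s ψ)
_⊨_ {M} s (φ ⊗ᶠ ψ) = ∃₂ λ (t₁ t₂ : State M) → s ≡ t₁ ∪ t₂ × _⊨_ {M} t₁ φ × _⊨_ {M} t₂ ψ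
_⊨_ {M} s (hole ())

_⊨_⩔_ : {M : Model} → State M → PD⁺ → PD⁺ → Set
_⊨_⩔_ {M} s ψ χ = (_⊨_ {M} s ψ) ⊎ (_⊨_ {M} s χ)

EquivDisj : Model → PD⁺ → PD⁺ → PD⁺ → Set
EquivDisj M φ ψ χ = ∀ (s : State M) → (_⊨_ {M} s φ) ⇔ (_⊨_⩔_ {M} s ψ χ)

OccursCl : Atom → Cl → Set
OccursCl r (atm x)  = r ≡ x
OccursCl r (natm x) = r ≡ x
OccursCl r bot      = ⊥
OccursCl r (α ∧ᶜ β) = OccursCl r α ⊎ OccursCl r β
OccursCl r (α ⊗ᶜ β) = OccursCl r α ⊎ OccursCl r β

OccursCl* : Atom → List Cl → Set
OccursCl* r []       = ⊥
OccursCl* r (α ∷ αs) = OccursCl r α ⊎ OccursCl* r αs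

Occurs : {H : Set} → Atom → Form H → Set
Occurs r (atm x)    = r ≡ x
Occurs r (natm x)   = r ≡ x
Occurs r bot        = ⊥
Occurs r (dep αs β) = OccursCl* r αs ⊎ OccursCl r β
Occurs r (φ ∧ᶠ ψ)   = Occurs r φ ⊎ Occurs r ψ
Occurs r (φ ⊗ᶠ ψ)   = Occurs r φ ⊎ Occurs r ψ
Occurs r (hole h)   = ⊥

-- The model M_pq: worlds w₁,w₂,w₃ = 0,1,2; p true at w₁,w₂; q true at w₂,w₃;
-- every other atom false everywhere.
inP : Fin 3 → Bool
inP zero = true
inP (suc zero) = true
inP (suc (suc zero)) = false

inQ : Fin 3 → Bool
inQ zero = false
inQ (suc zero) = true
inQ (suc (suc zero)) = true

Mpq : Atom → Atom → Model
Mpq p q = record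
  { size = 3
  ; val  = λ w r → ((r ≡ᵇ p) ∧ inP w) ∨ ((r ≡ᵇ q) ∧ inQ w)
  }

-- In M_pq every letter other than p and q is false at all worlds, so for a
-- p,q-free context φ the states supporting φ(=(p), =(q)) form one of six
-- families: {∅}, the states of size at most one, the proper states, the
-- states supporting =(p), those supporting =(q), and all states.  These six
-- are closed under intersection (for ∧) and pairwise unions (for ⊗), and each
-- of them containing {w₁,w₂} and {w₂,w₃} also contains {w₁,w₃}; yet
-- =(p) ∨ =(q) is supported by {w₁,w₂} and by {w₂,w₃} but not by {w₁,w₃}.

module Submission where

open import Defs
open import Data.Product using (_×_; _,_; proj₁; proj₂; ∃₂)
open import Relation.Nullary using (¬_)
open import Relation.Binary.PropositionalEquality using (_≢_; _≡_; refl; sym) renaming (subst to ≡-subst)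

open import Data.Bool using (Bool; true; false; not; _∧_; _∨_; T)
open import Data.Bool.Properties using (T?; ∨-identityʳ) renaming (_≟_ to _≟ᵇ_)
open import Data.Empty using (⊥; ⊥-elim)
open import Data.Fin using (Fin)
open import Data.Fin.Properties using (all?)
open import Data.Fin.Subset using (Subset; _∈_; _∪_; ⁅_⁆) renaming (⊥ to ∅)
open import Data.Fin.Subset.Properties
  using (anySubset?; _∈?_; x∈⁅x⁆; x∈⁅y⁆⇒x≡y; ∉⊥; Empty-unique)
open import Data.Nat using (ℕ; _≡ᵇ_)
open import Data.Nat.Properties using (≡ᵇ⇒≡)
open import Data.Sum using (inj₁; inj₂)
open import Data.Unit using (tt)
open import Data.Vec using ([]; _∷_)
open import Data.Vec.Properties using (≡-dec)
open import Function using (_∘_; id)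
open import Relation.Nullary.Decidable
  using (Dec; map′; ¬?; _×-dec_; _→-dec_; from-yes; decidable-stable)
open import Relation.Unary using (Decidable)

private
  variable
    A B C : Set
    n : ℕ

⇔-trans : A ⇔ B → B ⇔ C → A ⇔ C
⇔-trans (f , g) (h , k) = h ∘ f , g ∘ k

_⇔-dec_ : Dec A → Dec B → Dec (A ⇔ B)
a? ⇔-dec b? = (a? →-dec b?) ×-dec (b? →-dec a?)

allSubset? : {P : Subset n → Set} → Decidable P → Dec (∀ s → P s)
allSubset? P? =
  map′ (λ ¬∃¬P s → decidable-stable (P? s) (λ ¬Ps → ¬∃¬P (s , ¬Ps)))
       (λ ∀P (s , ¬Ps) → ¬Ps (∀P s))
       (¬? (anySubset? (¬? ∘ P?)))

_≟ˢ_ : (s t : Subset n) → Dec (s ≡ t)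
_≟ˢ_ = ≡-dec _≟ᵇ_

≡ᵇ-refl : ∀ m → (m ≡ᵇ m) ≡ true
≡ᵇ-refl ℕ.zero    = refl
≡ᵇ-refl (ℕ.suc m) = ≡ᵇ-refl m

≢⇒≡ᵇ≡false : ∀ {m n} → m ≢ n → (m ≡ᵇ n) ≡ false
≢⇒≡ᵇ≡false {m} {n} m≢n with m ≡ᵇ n in eq
... | false = refl
... | true  = ⊥-elim (m≢n (≡ᵇ⇒≡ m n (≡-subst T (sym eq) tt)))

⊨-atm-false : ∀ {M r} {s : State M} → (∀ w → val M w r ≡ false) →
  (_⊨_ {M} s (atm r)) ⇔ (s ≡ ∅)
⊨-atm-false {M} {r} {s} false-everywhere =
  (λ supp → Empty-unique (λ (w , w∈s) → never w (supp w w∈s))) ,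
  (λ { refl w w∈∅ → ⊥-elim (∉⊥ w∈∅) })
  where
  never : ∀ w → T (val M w r) → ⊥
  never w = ≡-subst T (false-everywhere w)

Constant : (Fin n → Bool) → Subset n → Set
Constant f s = ∀ w w' → w ∈ s → w' ∈ s → T (f w) → T (f w')

constant? : (f : Fin n → Bool) → Decidable (Constant f)
constant? f s =
  all? λ w → all? λ w' → (w ∈? s) →-dec (w' ∈? s) →-dec (T? (f w) →-dec T? (f w'))

Constant-cong : {f g : Fin n → Bool} {s : Subset n} →
  (∀ w → f w ≡ g w) → Constant f s → Constant g s
Constant-cong f≗g c w w' w∈s w'∈s =
  ≡-subst T (f≗g w') ∘ c w w' w∈s w'∈s ∘ ≡-subst T (sym (f≗g w))

⊨ᶜ-atm-singleton : ∀ {M r} w → (_⊨ᶜ_ {M} ⁅ w ⁆ (atm r)) ⇔ T (val M w r)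
⊨ᶜ-atm-singleton {M} {r} w =
  (λ supp → supp w (x∈⁅x⁆ w)) ,
  (λ v u u∈⁅w⁆ → ≡-subst (λ x → T (val M x r)) (sym (x∈⁅y⁆⇒x≡y w u∈⁅w⁆)) v)

⊨-const : ∀ {M r} {s : State M} → (_⊨_ {M} s (const r)) ⇔ Constant (λ w → val M w r) s
⊨-const {M} {r} =
  (λ supp w w' w∈s w'∈s v →
     proj₁ (⊨ᶜ-atm-singleton {M} {r} w')
       (proj₁ (supp w w' w∈s w'∈s (id , id)) (proj₂ (⊨ᶜ-atm-singleton {M} {r} w) v))) ,
  (λ c w w' w∈s w'∈s _ →
     lift (c w w' w∈s w'∈s) , lift (c w' w w'∈s w∈s))
  where
  lift : ∀ {w w'} → (T (val M w r) → T (val M w' r)) →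
    _⊨ᶜ_ {M} ⁅ w ⁆ (atm r) → _⊨ᶜ_ {M} ⁅ w' ⁆ (atm r)
  lift {w} {w'} f = proj₂ (⊨ᶜ-atm-singleton {M} {r} w') ∘ f ∘ proj₁ (⊨ᶜ-atm-singleton {M} {r} w)

data Family : Set where
  empty singletons proper p-constant q-constant all : Family

⟦_⟧ : Family → Subset 3 → Bool
⟦ empty      ⟧ (x ∷ y ∷ z ∷ []) = not (x ∨ y ∨ z)
⟦ singletons ⟧ (x ∷ y ∷ z ∷ []) = not (x ∧ y ∨ x ∧ z ∨ y ∧ z)
⟦ proper     ⟧ (x ∷ y ∷ z ∷ []) = not (x ∧ y ∧ z)
⟦ p-constant ⟧ (x ∷ y ∷ z ∷ []) = not (x ∧ z ∨ y ∧ z)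
⟦ q-constant ⟧ (x ∷ y ∷ z ∷ []) = not (x ∧ y ∨ x ∧ z)
⟦ all        ⟧ _                = true

_⊓_ : Family → Family → Family
all        ⊓ G          = G
F          ⊓ all        = F
empty      ⊓ _          = empty
_          ⊓ empty      = empty
proper     ⊓ G          = G
F          ⊓ proper     = F
singletons ⊓ _          = singletons
_          ⊓ singletons = singletons
p-constant ⊓ p-constant = p-constant
q-constant ⊓ q-constant = q-constant
p-constant ⊓ q-constant = singletons
q-constant ⊓ p-constant = singletons

_⊗_ : Family → Family → Family
empty      ⊗ G          = G
F          ⊗ empty      = F
singletons ⊗ singletons = proper
_          ⊗ _          = all

allFamilies? : {P : Family → Set} → Decidable P → Dec (∀ F → P F)
allFamilies? P? =
  map′ (λ { (e , s , p , cp , cq , t) → λ { empty → e ; singletons → s ; proper → p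
                                          ; p-constant → cp ; q-constant → cq ; all → t } })
       (λ ∀P → ∀P empty , ∀P singletons , ∀P proper , ∀P p-constant , ∀P q-constant , ∀P all)
       (P? empty ×-dec P? singletons ×-dec P? proper ×-dec
        P? p-constant ×-dec P? q-constant ×-dec P? all)

_represents_ : Family → (Subset 3 → Set) → Set
F represents P = ∀ s → P s ⇔ T (⟦ F ⟧ s)

Sum : (Subset n → Set) → (Subset n → Set) → Subset n → Set
Sum P Q s = ∃₂ λ t₁ t₂ → s ≡ t₁ ∪ t₂ × P t₁ × Q t₂

⊓-represents : ∀ F G → (F ⊓ G) represents (λ s → T (⟦ F ⟧ s) × T (⟦ G ⟧ s))
⊓-represents = from-yes
  (allFamilies? λ F → allFamilies? λ G → allSubset? λ s →
     (T? (⟦ F ⟧ s) ×-dec T? (⟦ G ⟧ s)) ⇔-dec T? (⟦ F ⊓ G ⟧ s))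

⊗-represents : ∀ F G → (F ⊗ G) represents Sum (T ∘ ⟦ F ⟧) (T ∘ ⟦ G ⟧)
⊗-represents = from-yes
  (allFamilies? λ F → allFamilies? λ G → allSubset? λ s →
     anySubset? (λ t₁ → anySubset? λ t₂ →
       (s ≟ˢ (t₁ ∪ t₂)) ×-dec T? (⟦ F ⟧ t₁) ×-dec T? (⟦ G ⟧ t₂))
     ⇔-dec T? (⟦ F ⊗ G ⟧ s))

empty-represents : empty represents (_≡ ∅)
empty-represents = from-yes (allSubset? λ s → (s ≟ˢ ∅) ⇔-dec T? (⟦ empty ⟧ s))

p-constant-represents : p-constant represents Constant inP
p-constant-represents = from-yes (allSubset? λ s → constant? inP s ⇔-dec T? (⟦ p-constant ⟧ s))

q-constant-represents : q-constant represents Constant inQ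
q-constant-represents = from-yes (allSubset? λ s → constant? inQ s ⇔-dec T? (⟦ q-constant ⟧ s))

singleton-invariant : ∀ F w w' → T (⟦ F ⟧ ⁅ w ⁆) → T (⟦ F ⟧ ⁅ w' ⁆)
singleton-invariant = from-yes
  (allFamilies? λ F → all? λ w → all? λ w' → T? (⟦ F ⟧ ⁅ w ⁆) →-dec T? (⟦ F ⟧ ⁅ w' ⁆))

w₁w₂ w₂w₃ w₁w₃ : Subset 3
w₁w₂ = true  ∷ true  ∷ false ∷ []
w₂w₃ = false ∷ true  ∷ true  ∷ []
w₁w₃ = true  ∷ false ∷ true  ∷ []

w₁w₂∈∧w₂w₃∈⇒w₁w₃∈ : ∀ F → T (⟦ F ⟧ w₁w₂) → T (⟦ F ⟧ w₂w₃) → T (⟦ F ⟧ w₁w₃)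
w₁w₂∈∧w₂w₃∈⇒w₁w₃∈ = from-yes
  (allFamilies? λ F → T? (⟦ F ⟧ w₁w₂) →-dec T? (⟦ F ⟧ w₂w₃) →-dec T? (⟦ F ⟧ w₁w₃))

all-represents : {P : Subset 3 → Set} → (∀ s → P s) → all represents P
all-represents always s = (λ _ → tt) , (λ _ → always s)

×-represents : ∀ {P Q} F G → F represents P → G represents Q →
  (F ⊓ G) represents (λ s → P s × Q s)
×-represents F G F≈P G≈Q s =
  ⇔-trans ((λ (x , y) → proj₁ (F≈P s) x , proj₁ (G≈Q s) y) ,
           (λ (x , y) → proj₂ (F≈P s) x , proj₂ (G≈Q s) y))
          (⊓-represents F G s)

Sum-represents : ∀ {P Q} F G → F represents P → G represents Q →
  (F ⊗ G) represents Sum P Q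
Sum-represents F G F≈P G≈Q s =
  ⇔-trans ((λ (t₁ , t₂ , s≡ , x , y) → t₁ , t₂ , s≡ , proj₁ (F≈P t₁) x , proj₁ (G≈Q t₂) y) ,
           (λ (t₁ , t₂ , s≡ , x , y) → t₁ , t₂ , s≡ , proj₂ (F≈P t₁) x , proj₂ (G≈Q t₂) y))
          (⊗-represents F G s)

cl-family : Cl → Family
cl-family (atm _)  = empty
cl-family (natm _) = all
cl-family bot      = empty
cl-family (α ∧ᶜ β) = cl-family α ⊓ cl-family β
cl-family (α ⊗ᶜ β) = cl-family α ⊗ cl-family β

family : {H : Set} → Form H → (H → Family) → Family
family (atm _)    ρ = empty
family (natm _)   ρ = all
family bot        ρ = empty
family (dep _ _)  ρ = all
family (φ ∧ᶠ ψ)   ρ = family φ ρ ⊓ family ψ ρ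
family (φ ⊗ᶠ ψ)   ρ = family φ ρ ⊗ family ψ ρ
family (hole h)   ρ = ρ h

module _ (p q : Atom) (p≢q : p ≢ q) where

  private
    M : Model
    M = Mpq p q

  ∥_∥ : PD⁺ → Subset 3 → Set
  ∥ φ ∥ s = _⊨_ {M} s φ

  ∥_∥ᶜ : Cl → Subset 3 → Set
  ∥ β ∥ᶜ s = _⊨ᶜ_ {M} s β

  val-p : ∀ w → val M w p ≡ inP w
  val-p w rewrite ≡ᵇ-refl p | ≢⇒≡ᵇ≡false p≢q = ∨-identityʳ (inP w)

  val-q : ∀ w → val M w q ≡ inQ w
  val-q w rewrite ≢⇒≡ᵇ≡false (p≢q ∘ sym) | ≡ᵇ-refl q = refl

  val-other : ∀ {r} → p ≢ r → q ≢ r → ∀ w → val M w r ≡ false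
  val-other p≢r q≢r w rewrite ≢⇒≡ᵇ≡false (p≢r ∘ sym) | ≢⇒≡ᵇ≡false (q≢r ∘ sym) = refl

  atm-represents : ∀ {r} → p ≢ r → q ≢ r → empty represents ∥ atm r ∥
  atm-represents {r} p≢r q≢r s = ⇔-trans (⊨-atm-false {M} {r} (val-other p≢r q≢r)) (empty-represents s)

  natm-represents : ∀ {r} → p ≢ r → q ≢ r → all represents ∥ natm r ∥
  natm-represents p≢r q≢r = all-represents λ s w _ → ≡-subst T (val-other p≢r q≢r w)

  const-p-represents : p-constant represents ∥ const p ∥
  const-p-represents s =
    ⇔-trans (⊨-const {M} {p})
      (⇔-trans (Constant-cong val-p , Constant-cong (sym ∘ val-p)) (p-constant-represents s))

  const-q-represents : q-constant represents ∥ const q ∥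
  const-q-represents s =
    ⇔-trans (⊨-const {M} {q})
      (⇔-trans (Constant-cong val-q , Constant-cong (sym ∘ val-q)) (q-constant-represents s))

  -- Classical atoms have the same support clauses as PD⁺ atoms, so the
  -- lemmas for the latter apply verbatim.
  cl-represents : ∀ β → ¬ OccursCl p β → ¬ OccursCl q β → cl-family β represents ∥ β ∥ᶜ
  cl-represents (atm r)  p∉ q∉ = atm-represents p∉ q∉
  cl-represents (natm r) p∉ q∉ = natm-represents p∉ q∉
  cl-represents bot      p∉ q∉ = empty-represents
  cl-represents (α ∧ᶜ β) p∉ q∉ =
    ×-represents (cl-family α) (cl-family β)
      (cl-represents α (p∉ ∘ inj₁) (q∉ ∘ inj₁)) (cl-represents β (p∉ ∘ inj₂) (q∉ ∘ inj₂))
  cl-represents (α ⊗ᶜ β) p∉ q∉ =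
    Sum-represents (cl-family α) (cl-family β)
      (cl-represents α (p∉ ∘ inj₁) (q∉ ∘ inj₁)) (cl-represents β (p∉ ∘ inj₂) (q∉ ∘ inj₂))

  dep-represents : ∀ αs β → ¬ OccursCl p β → ¬ OccursCl q β → all represents ∥ dep αs β ∥
  dep-represents αs β p∉ q∉ = all-represents λ s w w' _ _ _ → transfer w w' , transfer w' w
    where
    transfer : ∀ w w' → ∥ β ∥ᶜ ⁅ w ⁆ → ∥ β ∥ᶜ ⁅ w' ⁆
    transfer w w' =
      proj₂ (cl-represents β p∉ q∉ ⁅ w' ⁆)
      ∘ singleton-invariant (cl-family β) w w'
      ∘ proj₁ (cl-represents β p∉ q∉ ⁅ w ⁆)

  subst-represents : ∀ {H} (φ : Form H) (ρ : H → Family) {σ : H → PD⁺} →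
    ¬ Occurs p φ → ¬ Occurs q φ → (∀ h → ρ h represents ∥ σ h ∥) →
    family φ ρ represents ∥ subst φ σ ∥
  subst-represents (atm r)    ρ p∉ q∉ holes = atm-represents p∉ q∉
  subst-represents (natm r)   ρ p∉ q∉ holes = natm-represents p∉ q∉
  subst-represents bot        ρ p∉ q∉ holes = empty-represents
  subst-represents (dep αs β) ρ p∉ q∉ holes = dep-represents αs β (p∉ ∘ inj₂) (q∉ ∘ inj₂)
  subst-represents (φ ∧ᶠ ψ)   ρ p∉ q∉ holes =
    ×-represents (family φ ρ) (family ψ ρ)
      (subst-represents φ ρ (p∉ ∘ inj₁) (q∉ ∘ inj₁) holes)
      (subst-represents ψ ρ (p∉ ∘ inj₂) (q∉ ∘ inj₂) holes)
  subst-represents (φ ⊗ᶠ ψ)   ρ p∉ q∉ holes =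
    Sum-represents (family φ ρ) (family ψ ρ)
      (subst-represents φ ρ (p∉ ∘ inj₁) (q∉ ∘ inj₁) holes)
      (subst-represents ψ ρ (p∉ ∘ inj₂) (q∉ ∘ inj₂) holes)
  subst-represents (hole h)   ρ p∉ q∉ holes = holes h

  not-equivalent-in-Mpq : ∀ φ → ¬ Occurs p φ → ¬ Occurs q φ →
    ¬ EquivDisj M (φ [ const p , const q ]) (const p) (const q)
  not-equivalent-in-Mpq φ p∉ q∉ equiv =
    w₁w₃-unsupported (proj₁ (equiv w₁w₃) (proj₂ (φ≈ w₁w₃) (w₁w₂∈∧w₂w₃∈⇒w₁w₃∈ F w₁w₂∈F w₂w₃∈F)))
    where
    holeFamily : Hole → Family
    holeFamily a = p-constant
    holeFamily b = q-constant

    F : Family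
    F = family φ holeFamily

    φ≈ : F represents ∥ φ [ const p , const q ] ∥
    φ≈ = subst-represents φ holeFamily p∉ q∉ λ { a → const-p-represents ; b → const-q-represents }

    w₁w₂∈F : T (⟦ F ⟧ w₁w₂)
    w₁w₂∈F = proj₁ (φ≈ w₁w₂) (proj₂ (equiv w₁w₂) (inj₁ (proj₂ (const-p-represents w₁w₂) tt)))

    w₂w₃∈F : T (⟦ F ⟧ w₂w₃)
    w₂w₃∈F = proj₁ (φ≈ w₂w₃) (proj₂ (equiv w₂w₃) (inj₂ (proj₂ (const-q-represents w₂w₃) tt)))

    w₁w₃-unsupported : ¬ (_⊨_⩔_ {M} w₁w₃ (const p) (const q))
    w₁w₃-unsupported (inj₁ w₁w₃⊨=p) = proj₁ (const-p-represents w₁w₃) w₁w₃⊨=p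
    w₁w₃-unsupported (inj₂ w₁w₃⊨=q) = proj₁ (const-q-represents w₁w₃) w₁w₃⊨=q

theorem4p4 : ∀ (φ : Context) (p q : Atom) → p ≢ q → ¬ Occurs p φ → ¬ Occurs q φ →
    ¬ EquivDisj (Mpq p q) (φ [ const p , const q ]) (const p) (const q)
    × ¬ (∀ (M : Model) → EquivDisj M (φ [ const p , const q ]) (const p) (const q))
theorem4p4 φ p q p≢q p∉ q∉ =
  not-equivalent-in-Mpq p q p≢q φ p∉ q∉ ,
  λ equivalent → not-equivalent-in-Mpq p q p≢q φ p∉ q∉ (equivalent (Mpq p q))
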